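{- Let $k\ge2$ and let $\pi\in\mathcal S_n$, where $n\not\equiv2\pmod4$. Then $\pi\in\mathcal P(\Sigma^-_k)$ if and only if $\hat\pi$ has at most $k-1$ ascents.
   Context: Let $\mathcal W_k$ be the set of infinite words over $\{0,\dots,k-1\}$ with the order $\prec$: for $s\ne t$ with $j$ the first index where they differ, $s\prec t$ iff ($j-1$ even and $s_j<t_j$) or ($j-1$ odd and $s_j>t_j$). The reverse $k$-shift $\Sigma^-_k$ deletes the first letter of a word. For $m\ge1$ and $s=(s_1\dots s_m)^\infty$ with $s_1\dots s_m$ primitive (not a power of a shorter word), the periodic pattern of $s$ is the permutation $\rho\in\mathcal S_m$ with $\rho_i<\rho_j$ iff $s_is_{i+1}\dots\prec s_js_{j+1}\dots$; $\mathcal P(\Sigma^-_k)$ is the set of all such periodic patterns (over all $m$). For $\pi\in\mathcal S_n$, $\hat\pi$ is the cyclic permutation $(\pi_1,\dots,\pi_n)$ in cycle notation, i.e. $\hat\pi_{\pi_i}=\pi_{i+1}$ with $\pi_{n+1}=\pi_1$. An ascent of $\tau\in\mathcal S_n$ (one-line notation) is an $i\in[n-1]$ with $\tau_i<\tau_{i+1}$. -}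

module Defs where

open import Data.Nat using (ℕ; zero; suc; _+_; _*_; _∸_; _≤_; _<_; _<?_; NonZero)
open import Data.Nat.DivMod using (_%_; _mod_)
open import Data.Nat.Divisibility using (_∣_)
open import Data.Fin as F using (Fin; toℕ)
open import Data.Fin.Permutation using (Permutation′; _⟨$⟩ʳ_; _⟨$⟩ˡ_)
open import Data.List using (List; length; filter; upTo)
open import Data.Product using (Σ; ∃; ∃-syntax; _×_)
open import Data.Sum using (_⊎_)
open import Function.Bundles using (_⇔_)
open import Relation.Binary.PropositionalEquality using (_≡_)
open import Relation.Nullary using (¬_)

-- Infinite words over {0,…,k-1}, indexed from 0 (letter s_{j} of the paper is s (j-1)).
Word : ℕ → Set
Word k = ℕ → Fin k

-- The alternating order ≺: at the first differing (0-based) index j,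
-- (paper's index j+1, so "j+1-1 = j even") s j < t j if j is even, s j > t j if j is odd.
_≺_ : ∀ {k} → Word k → Word k → Set
s ≺ t = ∃[ j ] ((∀ i → i < j → s i ≡ t i)
               × ((j % 2 ≡ 0 × s j F.< t j) ⊎ (j % 2 ≡ 1 × t j F.< s j)))

shift : ∀ {k} → ℕ → Word k → Word k
shift i s t = s (i + t)

periodic : ∀ {k n} .{{_ : NonZero n}} → (Fin n → Fin k) → Word k
periodic {n = n} w i = w (i mod n)

Primitive : ∀ {k n} → (Fin n → Fin k) → Set
Primitive {k} {n} w =
  ¬ (∃[ d ] Σ (Fin (suc d) → Fin k) λ u →
       suc d < n × suc d ∣ n × (∀ (i : Fin n) → w i ≡ u (toℕ i mod suc d)))

-- ρ is the periodic pattern of w^∞ (positions 1..n of the paper are Fin n indices 0..n-1).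
IsPatternOf : ∀ {k n} .{{_ : NonZero n}} → Permutation′ n → (Fin n → Fin k) → Set
IsPatternOf {n = n} ρ w =
  ∀ (i j : Fin n) →
    ((ρ ⟨$⟩ʳ i) F.< (ρ ⟨$⟩ʳ j)) ⇔ (shift (toℕ i) (periodic w) ≺ shift (toℕ j) (periodic w))

-- π ∈ 𝒫(Σ⁻_k): π is the periodic pattern of some (w)^∞ with w primitive of length n.
InPatterns : (k : ℕ) → ∀ {n} .{{_ : NonZero n}} → Permutation′ n → Set
InPatterns k {n} π = Σ (Fin n → Fin k) λ w → Primitive w × IsPatternOf π w

-- π̂ = the cycle (π_1,…,π_n): π̂(π_i) = π_{i+1}, π_{n+1} = π_1.
hat : ∀ {n} .{{_ : NonZero n}} → Permutation′ n → Fin n → Fin n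
hat {n} π x = π ⟨$⟩ʳ ((suc (toℕ (π ⟨$⟩ˡ x))) mod n)

ascents : ∀ {n} .{{_ : NonZero n}} → (Fin n → Fin n) → ℕ
ascents {n} τ = length (filter (λ i → τℕ i <? τℕ (suc i)) (upTo (n ∸ 1)))
  where
  τℕ : ℕ → ℕ
  τℕ m = toℕ (τ (m mod n))

-- Write val x for the value of π and u x for the letter of w^∞ at the cyclic position x.
-- Comparing the tails at a and b letter by letter, π is the pattern of w^∞ only if w is
-- compatible with π: val a < val b forces u a < u b, or u a = u b and val (b+1) < val (a+1).
-- Read in increasing order of values, the letters of a compatible word increase weakly, and
-- strictly at every ascent of π̂, so k letters allow at most k − 1 ascents; conversely,
-- labelling each value by the number of ascents of π̂ below it gives a compatible word.
-- A compatible word has π as the pattern of its tails unless two tails coincide, i.e. unless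
-- w has a proper period d. On equal tails the second alternative applies forever, so along an
-- even multiple e of d the values val 0, val e, val 2e, … are strictly monotone unless n ∣ e.
-- This forces n = 2d with d odd, which n ≢ 2 (mod 4) excludes.

module Submission where

open import Defs
open import Data.Nat using (ℕ; zero; suc; _+_; _*_; _∸_; _≤_; _<_; _>_; _<?_; _≤′_; ≤′-refl; ≤′-step; NonZero; >-nonZero; z≤n; s≤s; z<s; pred)
open import Data.Nat.Properties
open import Data.Nat.DivMod
open import Data.Nat.Divisibility using (_∣_; divides; ∣-refl; ∣⇒≤; m%n≡0⇒n∣m)
open import Data.Fin as F using (Fin; toℕ; fromℕ<)
open import Data.Fin.Properties using (toℕ-injective; toℕ-fromℕ<; toℕ<n) renaming (<-cmp to <-cmpᶠ)
open import Data.Fin.Permutation using (Permutation′; _⟨$⟩ʳ_; _⟨$⟩ˡ_; inverseˡ; inverseʳ)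
open import Data.List using (length; filter; upTo; [_]; _++_)
open import Data.List.Properties using (upTo-∷ʳ; filter-++; length-++; length-filter; filter-accept; filter-reject)
open import Data.Product using (∃-syntax; _×_; _,_)
open import Data.Sum using (_⊎_; inj₁; inj₂)
open import Data.Empty using (⊥-elim)
open import Function.Bundles using (_⇔_; mk⇔; Equivalence)
open import Relation.Binary.Core using (Rel)
open import Relation.Binary.Definitions using (Transitive; tri<; tri≈; tri>)
open import Relation.Binary.PropositionalEquality hiding ([_])
open import Relation.Nullary using (¬_; contradiction)
open import Relation.Unary using (Pred; Decidable)

module _ {k : ℕ} where

  LessAt : Word k → Word k → ℕ → Set
  LessAt s t j = (j % 2 ≡ 0 × s j F.< t j) ⊎ (j % 2 ≡ 1 × t j F.< s j)

  -- j % 2 computes on numerals, so two steps of recursion shift both words by two letters.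
  LessAt-suc⁺ : ∀ {s t : Word k} j → LessAt (shift 1 t) (shift 1 s) j → LessAt s t (suc j)
  LessAt-suc⁺ zero          (inj₁ (refl , l)) = inj₂ (refl , l)
  LessAt-suc⁺ zero          (inj₂ (() , _))
  LessAt-suc⁺ (suc zero)    (inj₁ (() , _))
  LessAt-suc⁺ (suc zero)    (inj₂ (refl , l)) = inj₁ (refl , l)
  LessAt-suc⁺ {s} {t} (suc (suc j)) less = LessAt-suc⁺ {shift 2 s} {shift 2 t} j less

  LessAt-suc⁻ : ∀ {s t : Word k} j → LessAt s t (suc j) → LessAt (shift 1 t) (shift 1 s) j
  LessAt-suc⁻ zero          (inj₁ (() , _))
  LessAt-suc⁻ zero          (inj₂ (refl , l)) = inj₁ (refl , l)
  LessAt-suc⁻ (suc zero)    (inj₁ (refl , l)) = inj₂ (refl , l)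
  LessAt-suc⁻ (suc zero)    (inj₂ (() , _))
  LessAt-suc⁻ {s} {t} (suc (suc j)) less = LessAt-suc⁻ {shift 2 s} {shift 2 t} j less

  LessAt⇒≢ : ∀ {s t : Word k} {j} → LessAt s t j → s j ≢ t j
  LessAt⇒≢ (inj₁ (_ , l)) s≡t = <-irrefl (cong toℕ s≡t) l
  LessAt⇒≢ (inj₂ (_ , l)) s≡t = <-irrefl (cong toℕ (sym s≡t)) l

  LessAt-asym : ∀ {s t : Word k} {j} → LessAt s t j → ¬ LessAt t s j
  LessAt-asym (inj₁ (_ , l)) (inj₁ (_ , l′)) = <-asym l l′
  LessAt-asym (inj₁ (even , _)) (inj₂ (odd , _)) = 0≢1+n (trans (sym even) odd)
  LessAt-asym (inj₂ (odd , _)) (inj₁ (even , _)) = 0≢1+n (trans (sym even) odd)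
  LessAt-asym (inj₂ (_ , l)) (inj₂ (_ , l′)) = <-asym l l′

  ≺-irrefl : ∀ {s : Word k} → ¬ s ≺ s
  ≺-irrefl {s} (_ , _ , less) = LessAt⇒≢ {s} {s} less refl

  ≺-asym : ∀ {s t : Word k} → s ≺ t → ¬ t ≺ s
  ≺-asym {s} {t} (j₁ , agree₁ , less₁) (j₂ , agree₂ , less₂) with <-cmp j₁ j₂
  ... | tri< j₁<j₂ _ _ = LessAt⇒≢ {s} {t} less₁ (sym (agree₂ j₁ j₁<j₂))
  ... | tri> _ _ j₂<j₁ = LessAt⇒≢ {t} {s} less₂ (sym (agree₁ j₂ j₂<j₁))
  ... | tri≈ _ refl _ = LessAt-asym {s} {t} less₁ less₂

  ≺-resp-≗ : ∀ {s s′ t t′ : Word k} → s ≗ s′ → t ≗ t′ → s ≺ t → s′ ≺ t′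
  ≺-resp-≗ {s} {s′} {t} {t′} s≗s′ t≗t′ (j , agree , less) =
    j , (λ i i<j → trans (sym (s≗s′ i)) (trans (agree i i<j) (t≗t′ i))) , LessAt-resp less
    where
    LessAt-resp : LessAt s t j → LessAt s′ t′ j
    LessAt-resp (inj₁ (p , l)) = inj₁ (p , subst₂ F._<_ (s≗s′ j) (t≗t′ j) l)
    LessAt-resp (inj₂ (p , l)) = inj₂ (p , subst₂ F._<_ (t≗t′ j) (s≗s′ j) l)

  ≺-head : ∀ {s t : Word k} → s 0 F.< t 0 → s ≺ t
  ≺-head l = 0 , (λ _ ()) , inj₁ (refl , l)

  ≺-cons : ∀ {s t : Word k} → s 0 ≡ t 0 → shift 1 t ≺ shift 1 s → s ≺ t
  ≺-cons {s} {t} s₀≡t₀ (j , agree , less) = suc j , agree′ , LessAt-suc⁺ {s} {t} j less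
    where
    agree′ : ∀ i → i < suc j → s i ≡ t i
    agree′ zero    _         = s₀≡t₀
    agree′ (suc i) (s≤s i<j) = sym (agree i i<j)

  ≺-uncons : ∀ {s t : Word k} → s 0 ≡ t 0 → s ≺ t → shift 1 t ≺ shift 1 s
  ≺-uncons {s} {t} s₀≡t₀ (zero , _ , less) = contradiction s₀≡t₀ (LessAt⇒≢ {s} {t} less)
  ≺-uncons {s} {t} s₀≡t₀ (suc j , agree , less) =
    j , (λ i i<j → sym (agree (suc i) (s≤s i<j))) , LessAt-suc⁻ {s} {t} j less

  shift-head : ∀ (s : Word k) a → shift a s 0 ≡ s a
  shift-head s a = cong s (+-identityʳ a)

  shift-suc : ∀ (s : Word k) a → shift 1 (shift a s) ≗ shift (suc a) s
  shift-suc s a t = cong s (+-suc a t)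

  shift-≗-suc : ∀ {s : Word k} {a b} → shift a s ≗ shift b s → shift (suc a) s ≗ shift (suc b) s
  shift-≗-suc {s} {a} {b} a≗b t = begin
    s (suc a + t) ≡⟨ shift-suc s a t ⟨
    s (a + suc t) ≡⟨ a≗b (suc t) ⟩
    s (b + suc t) ≡⟨ shift-suc s b t ⟩
    s (suc b + t) ∎
    where open ≡-Reasoning

  shift-≗-+ : ∀ {s : Word k} {a b} → shift a s ≗ shift b s → ∀ c → shift (c + a) s ≗ shift (c + b) s
  shift-≗-+ a≗b zero    = a≗b
  shift-≗-+ {s} a≗b (suc c) = shift-≗-suc {s} (shift-≗-+ {s} a≗b c)

  shift-≺-head : ∀ (s : Word k) {a b} → s a F.< s b → shift a s ≺ shift b s
  shift-≺-head s {a} {b} l = ≺-head (subst₂ F._<_ (sym (shift-head s a)) (sym (shift-head s b)) l)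

  shift-≺-cons : ∀ (s : Word k) {a b} → s a ≡ s b → shift (suc b) s ≺ shift (suc a) s → shift a s ≺ shift b s
  shift-≺-cons s {a} {b} same prec =
    ≺-cons (trans (shift-head s a) (trans same (sym (shift-head s b))))
           (≺-resp-≗ (λ t → sym (shift-suc s b t)) (λ t → sym (shift-suc s a t)) prec)

  shift-≺-uncons : ∀ (s : Word k) {a b} → s a ≡ s b → shift a s ≺ shift b s → shift (suc b) s ≺ shift (suc a) s
  shift-≺-uncons s {a} {b} same prec =
    ≺-resp-≗ (shift-suc s b) (shift-suc s a)
             (≺-uncons (trans (shift-head s a) (trans same (sym (shift-head s b)))) prec)

module _ {p} {Q : Pred ℕ p} (Q? : Decidable Q) where

  countBelow : ℕ → ℕ
  countBelow r = length (filter Q? (upTo r))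

  countBelow-suc : ∀ r → countBelow (suc r) ≡ countBelow r + length (filter Q? [ r ])
  countBelow-suc r = begin
    length (filter Q? (upTo (suc r)))              ≡⟨ cong (λ xs → length (filter Q? xs)) (upTo-∷ʳ r) ⟨
    length (filter Q? (upTo r ++ [ r ]))           ≡⟨ cong length (filter-++ Q? (upTo r) [ r ]) ⟩
    length (filter Q? (upTo r) ++ filter Q? [ r ]) ≡⟨ length-++ (filter Q? (upTo r)) ⟩
    countBelow r + length (filter Q? [ r ])        ∎
    where open ≡-Reasoning

  countBelow-accept : ∀ {r} → Q r → countBelow (suc r) ≡ suc (countBelow r)
  countBelow-accept {r} q = begin
    countBelow (suc r)                      ≡⟨ countBelow-suc r ⟩
    countBelow r + length (filter Q? [ r ]) ≡⟨ cong (λ xs → countBelow r + length xs) (filter-accept Q? q) ⟩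
    countBelow r + 1                        ≡⟨ +-comm (countBelow r) 1 ⟩
    suc (countBelow r)                      ∎
    where open ≡-Reasoning

  countBelow-reject : ∀ {r} → ¬ Q r → countBelow (suc r) ≡ countBelow r
  countBelow-reject {r} ¬q = begin
    countBelow (suc r)                      ≡⟨ countBelow-suc r ⟩
    countBelow r + length (filter Q? [ r ]) ≡⟨ cong (λ xs → countBelow r + length xs) (filter-reject Q? ¬q) ⟩
    countBelow r + 0                        ≡⟨ +-identityʳ (countBelow r) ⟩
    countBelow r                            ∎
    where open ≡-Reasoning

  countBelow-suc-≤ : ∀ r → countBelow (suc r) ≤ suc (countBelow r)
  countBelow-suc-≤ r = begin
    countBelow (suc r)                      ≡⟨ countBelow-suc r ⟩
    countBelow r + length (filter Q? [ r ]) ≤⟨ +-monoʳ-≤ (countBelow r) (length-filter Q? [ r ]) ⟩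
    countBelow r + 1                        ≡⟨ +-comm (countBelow r) 1 ⟩
    suc (countBelow r)                      ∎
    where open ≤-Reasoning

  countBelow-mono : ∀ {r r′} → r ≤ r′ → countBelow r ≤ countBelow r′
  countBelow-mono r≤r′ = mono (≤⇒≤′ r≤r′)
    where
    mono : ∀ {r r′} → r ≤′ r′ → countBelow r ≤ countBelow r′
    mono ≤′-refl                 = ≤-refl
    mono {r} (≤′-step {r′} r≤r′) =
      ≤-trans (mono r≤r′) (subst (countBelow r′ ≤_) (sym (countBelow-suc r′)) (m≤m+n _ _))

module _ {a ℓ} {A : Set a} {_R_ : Rel A ℓ} (R-trans : Transitive _R_) where

  chain : (f : ℕ → A) → (∀ j → f j R f (suc j)) → ∀ j → f 0 R f (suc j)
  chain f step zero    = step 0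
  chain f step (suc j) = R-trans (chain f step j) (step (suc j))

even-or-odd : ∀ d → ∃[ q ] (d ≡ q * 2 ⊎ d ≡ suc (q * 2))
even-or-odd zero          = 0 , inj₁ refl
even-or-odd (suc zero)    = 0 , inj₂ refl
even-or-odd (suc (suc d)) with even-or-odd d
... | q , inj₁ refl = suc q , inj₁ refl
... | q , inj₂ refl = suc q , inj₂ refl

m∣n∧0<n<m*2⇒n≡m : ∀ {m n} → m ∣ n → 0 < n → n < m * 2 → n ≡ m
m∣n∧0<n<m*2⇒n≡m         (divides zero          refl) ()
m∣n∧0<n<m*2⇒n≡m {m}     (divides (suc zero)    n≡m)  _ _ = trans n≡m (+-identityʳ m)
m∣n∧0<n<m*2⇒n≡m {m} {n} (divides (suc (suc q)) n≡q*m) _ n<m*2 = contradiction m*2≤n (<⇒≱ n<m*2)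
  where
  m*2≤n : m * 2 ≤ n
  m*2≤n = begin
    m * 2             ≡⟨ *-comm m 2 ⟩
    m + (m + 0)       ≤⟨ +-monoʳ-≤ m (+-monoʳ-≤ m z≤n) ⟩
    m + (m + q * m)   ≡⟨ n≡q*m ⟨
    n                 ∎
    where open ≤-Reasoning

+-cong-% : ∀ n .{{_ : NonZero n}} {a b c d} → a % n ≡ b % n → c % n ≡ d % n → (a + c) % n ≡ (b + d) % n
+-cong-% n {a} {b} {c} {d} a≡b c≡d = begin
  (a + c) % n         ≡⟨ %-distribˡ-+ a c n ⟩
  (a % n + c % n) % n ≡⟨ cong₂ (λ x y → (x + y) % n) a≡b c≡d ⟩
  (b % n + d % n) % n ≡⟨ %-distribˡ-+ b d n ⟨
  (b + d) % n         ∎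
  where open ≡-Reasoning

suc-injective-% : ∀ n .{{_ : NonZero n}} {a b} → suc a % n ≡ suc b % n → a % n ≡ b % n
suc-injective-% n {a} {b} sa≡sb = trans (sym (suc+pred a)) (trans (+-cong-% n sa≡sb refl) (suc+pred b))
  where
  suc+pred : ∀ x → (suc x + pred n) % n ≡ x % n
  suc+pred x = begin
    (suc x + pred n) % n ≡⟨ cong (_% n) (+-suc x (pred n)) ⟨
    (x + suc (pred n)) % n ≡⟨ cong (λ m → (x + m) % n) (suc-pred n) ⟩
    (x + n) % n          ≡⟨ [m+n]%n≡m%n x n ⟩
    x % n                ∎
    where open ≡-Reasoning

module _ {n : ℕ} {{_ : NonZero n}} where

  toℕ-mod : ∀ x → toℕ (x mod n) ≡ x % n
  toℕ-mod x = toℕ-fromℕ< (m%n<n x n)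

  toℕ-mod-% : ∀ x → toℕ (x mod n) % n ≡ x % n
  toℕ-mod-% x = trans (cong (_% n) (toℕ-mod x)) (m%n%n≡m%n x n)

  mod-toℕ : (i : Fin n) → toℕ i mod n ≡ i
  mod-toℕ i = toℕ-injective (trans (toℕ-mod (toℕ i)) (m<n⇒m%n≡m (toℕ<n i)))

  mod-cong : ∀ {x y} → x % n ≡ y % n → x mod n ≡ y mod n
  mod-cong {x} {y} x≡y = toℕ-injective (trans (toℕ-mod x) (trans x≡y (sym (toℕ-mod y))))

  mod-injective : ∀ {x y} → x mod n ≡ y mod n → x % n ≡ y % n
  mod-injective {x} {y} x≡y = trans (sym (toℕ-mod x)) (trans (cong toℕ x≡y) (toℕ-mod y))

module CyclicPermutation {n : ℕ} {{_ : NonZero n}} (π : Permutation′ n) where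

  val : ℕ → ℕ
  val x = toℕ (π ⟨$⟩ʳ (x mod n))

  pos : ℕ → ℕ
  pos r = toℕ (π ⟨$⟩ˡ (r mod n))

  -- next r unfolds to val (suc (pos r)).
  next : ℕ → ℕ
  next r = toℕ (hat π (r mod n))

  val-cong : ∀ {x y} → x % n ≡ y % n → val x ≡ val y
  val-cong x≡y = cong (λ i → toℕ (π ⟨$⟩ʳ i)) (mod-cong x≡y)

  val-injective : ∀ {x y} → val x ≡ val y → x % n ≡ y % n
  val-injective {x} {y} vx≡vy = mod-injective (begin
    x mod n                         ≡⟨ inverseˡ π ⟨
    π ⟨$⟩ˡ (π ⟨$⟩ʳ (x mod n))         ≡⟨ cong (π ⟨$⟩ˡ_) (toℕ-injective vx≡vy) ⟩
    π ⟨$⟩ˡ (π ⟨$⟩ʳ (y mod n))         ≡⟨ inverseˡ π ⟩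
    y mod n                         ∎)
    where open ≡-Reasoning

  val<n : ∀ x → val x < n
  val<n x = toℕ<n (π ⟨$⟩ʳ (x mod n))

  val-toℕ : (i : Fin n) → val (toℕ i) ≡ toℕ (π ⟨$⟩ʳ i)
  val-toℕ i = cong (λ j → toℕ (π ⟨$⟩ʳ j)) (mod-toℕ i)

  val-pos : ∀ {r} → r < n → val (pos r) ≡ r
  val-pos {r} r<n = begin
    toℕ (π ⟨$⟩ʳ (pos r mod n))         ≡⟨ cong (λ i → toℕ (π ⟨$⟩ʳ i)) (mod-toℕ _) ⟩
    toℕ (π ⟨$⟩ʳ (π ⟨$⟩ˡ (r mod n)))    ≡⟨ cong toℕ (inverseʳ π) ⟩
    toℕ (r mod n)                     ≡⟨ toℕ-mod r ⟩
    r % n                             ≡⟨ m<n⇒m%n≡m r<n ⟩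
    r                                 ∎
    where open ≡-Reasoning

  pos-val : ∀ x → pos (val x) ≡ x % n
  pos-val x = begin
    toℕ (π ⟨$⟩ˡ (val x mod n))         ≡⟨ cong (λ i → toℕ (π ⟨$⟩ˡ i)) (mod-toℕ _) ⟩
    toℕ (π ⟨$⟩ˡ (π ⟨$⟩ʳ (x mod n)))    ≡⟨ cong toℕ (inverseˡ π) ⟩
    toℕ (x mod n)                     ≡⟨ toℕ-mod x ⟩
    x % n                             ∎
    where open ≡-Reasoning

  next-val : ∀ x → next (val x) ≡ val (suc x)
  next-val x = val-cong (+-cong-% n {1} refl (trans (cong (_% n) (pos-val x)) (m%n%n≡m%n x n)))

  next-injective : ∀ {r r′} → r < n → r′ < n → next r ≡ next r′ → r ≡ r′
  next-injective {r} {r′} r<n r′<n same = begin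
    r             ≡⟨ val-pos r<n ⟨
    val (pos r)   ≡⟨ val-cong (suc-injective-% n (val-injective same)) ⟩
    val (pos r′)  ≡⟨ val-pos r′<n ⟩
    r′            ∎
    where open ≡-Reasoning

  ascent? : Decidable (λ i → next i < next (suc i))
  ascent? i = next i <? next (suc i)

  -- ascents (hat π) unfolds to ascentsBelow (pred n).
  ascentsBelow : ℕ → ℕ
  ascentsBelow = countBelow ascent?

  descent-outside-ascents : ∀ {r} → suc r < n → ascentsBelow (suc r) ≡ ascentsBelow r → next (suc r) < next r
  descent-outside-ascents {r} sr<n same = ≤∧≢⇒< (≮⇒≥ no-ascent) distinct
    where
    no-ascent : ¬ next r < next (suc r)
    no-ascent ascent = 1+n≢n (trans (sym (countBelow-accept ascent? ascent)) same)
    distinct : next (suc r) ≢ next r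
    distinct eq = 1+n≢n (next-injective sr<n (<-trans (n<1+n r) sr<n) eq)

  descending-run : ∀ {r r′} → r < r′ → r′ < n → ascentsBelow r ≡ ascentsBelow r′ → next r′ < next r
  descending-run {r} {suc r′} (s≤s r≤r′) sr′<n same with m≤n⇒m<n∨m≡n r≤r′
  ... | inj₂ refl = descent-outside-ascents sr′<n (sym same)
  ... | inj₁ r<r′ = <-trans (descent-outside-ascents sr′<n flat)
                            (descending-run r<r′ (<-trans (n<1+n r′) sr′<n) (trans same flat))
    where
    flat : ascentsBelow (suc r′) ≡ ascentsBelow r′
    flat = ≤-antisym (subst (_≤ ascentsBelow r′) same (countBelow-mono ascent? (<⇒≤ r<r′)))
                     (countBelow-mono ascent? (n≤1+n r′))

  module _ {k : ℕ} (w : Fin n → Fin k) where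

    Compatible : Set
    Compatible = ∀ a b → val a < val b →
                 periodic w a F.< periodic w b ⊎ (periodic w a ≡ periodic w b × val (suc b) < val (suc a))

    periodic-cong : ∀ {x y} → x % n ≡ y % n → periodic w x ≡ periodic w y
    periodic-cong x≡y = cong w (mod-cong x≡y)

    shift-periodic-cong : ∀ {x y} → x % n ≡ y % n → shift x (periodic w) ≗ shift y (periodic w)
    shift-periodic-cong x≡y t = periodic-cong (+-cong-% n x≡y refl)

    pattern⇒≺ : IsPatternOf π w → ∀ {a b} → val a < val b → shift a (periodic w) ≺ shift b (periodic w)
    pattern⇒≺ pat {a} {b} a<b =
      ≺-resp-≗ (shift-periodic-cong (toℕ-mod-% a)) (shift-periodic-cong (toℕ-mod-% b))
               (Equivalence.to (pat (a mod n) (b mod n)) a<b)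

    pattern⇒< : IsPatternOf π w → ∀ {a b} → shift a (periodic w) ≺ shift b (periodic w) → val a < val b
    pattern⇒< pat {a} {b} a≺b =
      Equivalence.from (pat (a mod n) (b mod n))
        (≺-resp-≗ (shift-periodic-cong (sym (toℕ-mod-% a))) (shift-periodic-cong (sym (toℕ-mod-% b))) a≺b)

    ≺-of-<⇒pattern : (∀ {a b} → val a < val b → shift a (periodic w) ≺ shift b (periodic w)) → IsPatternOf π w
    ≺-of-<⇒pattern ≺-of-< i j = mk⇔
      (λ πi<πj → ≺-of-< (subst₂ _<_ (sym (val-toℕ i)) (sym (val-toℕ j)) πi<πj))
      (λ i≺j → subst₂ _<_ (val-toℕ i) (val-toℕ j) (<-of-≺ i≺j))
      where
      <-of-≺ : ∀ {a b} → shift a (periodic w) ≺ shift b (periodic w) → val a < val b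
      <-of-≺ {a} {b} a≺b with <-cmp (val a) (val b)
      ... | tri< a<b _ _ = a<b
      ... | tri≈ _ same _ =
        contradiction (≺-resp-≗ (λ _ → refl) (shift-periodic-cong (sym (val-injective same))) a≺b) ≺-irrefl
      ... | tri> _ _ b<a = contradiction (≺-of-< b<a) (≺-asym a≺b)

    pattern⇒compatible : IsPatternOf π w → Compatible
    pattern⇒compatible pat a b a<b with <-cmpᶠ (periodic w a) (periodic w b)
    ... | tri< wa<wb _ _ = inj₁ wa<wb
    ... | tri≈ _ same _  = inj₂ (same , pattern⇒< pat (shift-≺-uncons (periodic w) same (pattern⇒≺ pat a<b)))
    ... | tri> _ _ wb<wa = contradiction (pattern⇒< pat (shift-≺-head (periodic w) wb<wa)) (<-asym a<b)

    compatible⇒ascents< : Compatible → ascents (hat π) < k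
    compatible⇒ascents< compat = ≤-<-trans (ascentsBelow≤letter (m≤pred[n]⇒suc[m]≤n ≤-refl)) (toℕ<n _)
      where
      letter : ℕ → ℕ
      letter r = toℕ (periodic w (pos r))

      letter-step : ∀ {r} → suc r < n →
                    letter r < letter (suc r) ⊎ (letter r ≡ letter (suc r) × next (suc r) < next r)
      letter-step {r} sr<n
        with compat (pos r) (pos (suc r)) (subst₂ _<_ (sym (val-pos (<-trans (n<1+n r) sr<n))) (sym (val-pos sr<n)) (n<1+n r))
      ... | inj₁ letter< = inj₁ letter<
      ... | inj₂ (same , descent) = inj₂ (cong toℕ same , descent)

      ascentsBelow≤letter : ∀ {r} → r < n → ascentsBelow r ≤ letter r
      ascentsBelow≤letter {zero}  _    = z≤n
      ascentsBelow≤letter {suc r} sr<n with letter-step sr<n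
      ... | inj₁ letter< =
        ≤-trans (countBelow-suc-≤ ascent? r) (≤-<-trans (ascentsBelow≤letter (<-trans (n<1+n r) sr<n)) letter<)
      ... | inj₂ (same , descent) = begin
        ascentsBelow (suc r) ≡⟨ countBelow-reject ascent? (<-asym descent) ⟩
        ascentsBelow r       ≤⟨ ascentsBelow≤letter (<-trans (n<1+n r) sr<n) ⟩
        letter r             ≡⟨ same ⟩
        letter (suc r)       ∎
        where open ≤-Reasoning

    Period : ℕ → Set
    Period d = ∀ x → periodic w (d + x) ≡ periodic w x

    Aperiodic : Set
    Aperiodic = ∀ d → 0 < d → d < n → ¬ Period d

    period-+ : ∀ {d d′} → Period d → Period d′ → Period (d + d′)
    period-+ {d} {d′} p p′ x = begin
      periodic w (d + d′ + x)   ≡⟨ cong (periodic w) (+-assoc d d′ x) ⟩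
      periodic w (d + (d′ + x)) ≡⟨ p (d′ + x) ⟩
      periodic w (d′ + x)       ≡⟨ p′ x ⟩
      periodic w x              ∎
      where open ≡-Reasoning

    period-* : ∀ {d} → Period d → ∀ m → Period (m * d)
    period-* p zero    x = refl
    period-* p (suc m)   = period-+ p (period-* p m)

    period-shift : ∀ {d} → Period d → ∀ x → shift (d + x) (periodic w) ≗ shift x (periodic w)
    period-shift {d} p x t = trans (cong (periodic w) (+-assoc d x t)) (p (x + t))

    compatible-reverses : Compatible → ∀ {a b} → shift a (periodic w) ≗ shift b (periodic w) →
                          val a < val b → val (suc b) < val (suc a)
    compatible-reverses compat {a} {b} a≗b a<b with compat a b a<b
    ... | inj₂ (_ , descent) = descent
    ... | inj₁ wa<wb =
      contradiction (trans (sym (shift-head (periodic w) a)) (trans (a≗b 0) (shift-head (periodic w) b)))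
                    (λ same → <-irrefl (cong toℕ same) wa<wb)

    compatible-preserves-even : Compatible → ∀ m {a b} → shift a (periodic w) ≗ shift b (periodic w) →
                                val a < val b → val (m * 2 + a) < val (m * 2 + b)
    compatible-preserves-even compat zero    a≗b a<b = a<b
    compatible-preserves-even compat (suc m) {a} {b} a≗b a<b =
      compatible-reverses compat (λ t → sym (shift-≗-suc {s = periodic w} a′≗b′ t))
        (compatible-reverses compat a′≗b′ (compatible-preserves-even compat m a≗b a<b))
      where
      a′≗b′ : shift (m * 2 + a) (periodic w) ≗ shift (m * 2 + b) (periodic w)
      a′≗b′ = shift-≗-+ {s = periodic w} a≗b (m * 2)

    -- Along the orbit 0, e, 2e, … the values of π would be strictly monotone unless e ≡ 0 (mod n).
    compatible-even-period : Compatible → ∀ m → Period (m * 2) → n ∣ m * 2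
    compatible-even-period compat m p = m%n≡0⇒n∣m e n e%n≡0
      where
      e : ℕ
      e = m * 2

      orbit : ℕ → ℕ
      orbit j = val (j * e)

      up : orbit 0 < orbit 1 → ∀ j → orbit j < orbit (suc j)
      up start zero    = start
      up start (suc j) = compatible-preserves-even compat m (λ t → sym (period-shift p (j * e) t)) (up start j)

      down : orbit 1 < orbit 0 → ∀ j → orbit (suc j) < orbit j
      down start zero    = start
      down start (suc j) = compatible-preserves-even compat m (period-shift p (j * e)) (down start j)

      orbit-returns : orbit (suc (pred n)) ≡ orbit 0
      orbit-returns = val-cong (begin
        suc (pred n) * e % n ≡⟨ cong (λ l → l * e % n) (suc-pred n) ⟩
        n * e % n            ≡⟨ cong (_% n) (*-comm n e) ⟩
        e * n % n            ≡⟨ m*n%n≡0 e n ⟩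
        0                    ≡⟨ m*n%n≡0 0 n ⟨
        0 % n                ∎)
        where open ≡-Reasoning

      orbit-fixed : orbit 0 ≡ orbit 1
      orbit-fixed with <-cmp (orbit 0) (orbit 1)
      ... | tri< start _ _ =
        contradiction orbit-returns (>⇒≢ (chain {_R_ = _<_} <-trans orbit (up start) (pred n)))
      ... | tri≈ _ same _  = same
      ... | tri> _ _ start =
        contradiction orbit-returns (<⇒≢ (chain {_R_ = _>_} (λ x>y y>z → <-trans y>z x>y) orbit (down start) (pred n)))

      e%n≡0 : e % n ≡ 0
      e%n≡0 = begin
        e % n     ≡⟨ cong (_% n) (*-identityˡ e) ⟨
        1 * e % n ≡⟨ val-injective orbit-fixed ⟨
        0 % n     ≡⟨ m*n%n≡0 0 n ⟩
        0         ∎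
        where open ≡-Reasoning

    compatible⇒aperiodic : n % 4 ≢ 2 → Compatible → Aperiodic
    compatible⇒aperiodic n%4≢2 compat d 0<d d<n p with even-or-odd d
    ... | q , inj₁ refl = <⇒≱ d<n (∣⇒≤ {{>-nonZero 0<d}} (compatible-even-period compat q p))
    ... | q , inj₂ refl = n%4≢2 (begin
      n % 4               ≡⟨ cong (_% 4) d*2≡n ⟨
      (2 + q * 2 * 2) % 4 ≡⟨ cong (λ l → (2 + l) % 4) (*-assoc q 2 2) ⟩
      (2 + q * 4) % 4     ≡⟨ [m+kn]%n≡m%n 2 q 4 ⟩
      2                   ∎)
      where
      open ≡-Reasoning
      d*2≡n : d * 2 ≡ n
      d*2≡n = m∣n∧0<n<m*2⇒n≡m (compatible-even-period compat d (subst Period (*-comm 2 d) (period-* p 2)))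
                               (*-monoˡ-< 2 0<d) (*-monoˡ-< 2 d<n)

    aperiodic⇒primitive : Aperiodic → Primitive w
    aperiodic⇒primitive aperiodic (d-1 , v , d<n , d∣n , w≡v) = aperiodic d z<s d<n period
      where
      d : ℕ
      d = suc d-1
      through-v : ∀ x → periodic w x ≡ v (x mod d)
      through-v x = trans (w≡v (x mod n))
        (cong v (mod-cong {x = toℕ (x mod n)} {x} (trans (cong (_% d) (toℕ-mod x)) (m∣n⇒o%n%m≡o%m d n x d∣n))))
      period : Period d
      period x = begin
        periodic w (d + x) ≡⟨ through-v (d + x) ⟩
        v ((d + x) mod d)  ≡⟨ cong v (mod-cong {x = d + x} {x} (%-remove-+ˡ x ∣-refl)) ⟩
        v (x mod d)        ≡⟨ through-v x ⟨
        periodic w x       ∎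
        where open ≡-Reasoning

    agree-on-period⇒≗ : ∀ {a b} → (∀ t → t < n → periodic w (a + t) ≡ periodic w (b + t)) →
                        shift a (periodic w) ≗ shift b (periodic w)
    agree-on-period⇒≗ {a} {b} agree t = begin
      periodic w (a + t)     ≡⟨ periodic-cong (+-cong-% n refl (m%n%n≡m%n t n)) ⟨
      periodic w (a + t % n) ≡⟨ agree (t % n) (m%n<n t n) ⟩
      periodic w (b + t % n) ≡⟨ periodic-cong (+-cong-% n refl (m%n%n≡m%n t n)) ⟩
      periodic w (b + t)     ∎
      where open ≡-Reasoning

    -- Position x is reached from a by t = (n ∸ a) + x, and then b + t ≡ (b ∸ a) + x (mod n).
    ≗⇒period : ∀ {a b} → a ≤ b → a ≤ n → shift a (periodic w) ≗ shift b (periodic w) → Period (b ∸ a)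
    ≗⇒period {a} {b} a≤b a≤n a≗b x = begin
      periodic w (d + x)       ≡⟨ periodic-cong (+-cong-% n refl (%-remove-+ˡ x ∣-refl)) ⟨
      periodic w (d + (n + x)) ≡⟨ cong (periodic w) b+t≡d+[n+x] ⟨
      periodic w (b + t)       ≡⟨ a≗b t ⟨
      periodic w (a + t)       ≡⟨ cong (periodic w) a+t≡n+x ⟩
      periodic w (n + x)       ≡⟨ periodic-cong (%-remove-+ˡ x ∣-refl) ⟩
      periodic w x             ∎
      where
      open ≡-Reasoning
      d t : ℕ
      d = b ∸ a
      t = n ∸ a + x
      a+t≡n+x : a + t ≡ n + x
      a+t≡n+x = trans (sym (+-assoc a (n ∸ a) x)) (cong (_+ x) (m+[n∸m]≡n a≤n))
      b+t≡d+[n+x] : b + t ≡ d + (n + x)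
      b+t≡d+[n+x] = begin
        b + t         ≡⟨ cong (_+ t) (m∸n+n≡m a≤b) ⟨
        d + a + t     ≡⟨ +-assoc d a t ⟩
        d + (a + t)   ≡⟨ cong (d +_) a+t≡n+x ⟩
        d + (n + x)   ∎

    aperiodic-shifts-differ : Aperiodic → ∀ {a b} → a < b → b < n → ¬ (shift a (periodic w) ≗ shift b (periodic w))
    aperiodic-shifts-differ aperiodic {a} {b} a<b b<n a≗b =
      aperiodic (b ∸ a) (m<n⇒0<n∸m a<b) (≤-<-trans (m∸n≤m b a) b<n)
                (≗⇒period (<⇒≤ a<b) (<⇒≤ (<-trans a<b b<n)) a≗b)

    compatible-≺-or-agree : Compatible → ∀ T {a b} → val a < val b →
                            shift a (periodic w) ≺ shift b (periodic w) ⊎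
                            (∀ t → t < T → periodic w (a + t) ≡ periodic w (b + t))
    compatible-≺-or-agree compat zero    a<b = inj₂ (λ _ ())
    compatible-≺-or-agree compat (suc T) {a} {b} a<b with compat a b a<b
    ... | inj₁ wa<wb = inj₁ (shift-≺-head (periodic w) wa<wb)
    ... | inj₂ (same , descent) with compatible-≺-or-agree compat T descent
    ...   | inj₁ prec  = inj₁ (shift-≺-cons (periodic w) same prec)
    ...   | inj₂ agree = inj₂ agree′
      where
      agree′ : ∀ t → t < suc T → periodic w (a + t) ≡ periodic w (b + t)
      agree′ zero    _         = trans (shift-head (periodic w) a) (trans same (sym (shift-head (periodic w) b)))
      agree′ (suc t) (s≤s t<T) =
        trans (shift-suc (periodic w) a t) (trans (sym (agree t t<T)) (sym (shift-suc (periodic w) b t)))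

    ≗⇒≗-% : ∀ {a b} → shift a (periodic w) ≗ shift b (periodic w) →
            shift (a % n) (periodic w) ≗ shift (b % n) (periodic w)
    ≗⇒≗-% {a} {b} a≗b t =
      trans (shift-periodic-cong (m%n%n≡m%n a n) t) (trans (a≗b t) (sym (shift-periodic-cong (m%n%n≡m%n b n) t)))

    compatible⇒≺ : Compatible → Aperiodic →
                   ∀ {a b} → val a < val b → shift a (periodic w) ≺ shift b (periodic w)
    compatible⇒≺ compat aperiodic {a} {b} a<b with compatible-≺-or-agree compat n a<b
    ... | inj₁ prec  = prec
    ... | inj₂ agree = ⊥-elim (residues-differ (≗⇒≗-% (agree-on-period⇒≗ agree)))
      where
      residues-differ : ¬ (shift (a % n) (periodic w) ≗ shift (b % n) (periodic w))
      residues-differ ra≗rb with <-cmp (a % n) (b % n)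
      ... | tri< ra<rb _ _ = aperiodic-shifts-differ aperiodic ra<rb (m%n<n b n) ra≗rb
      ... | tri≈ _ same _  = <⇒≢ a<b (val-cong same)
      ... | tri> _ _ rb<ra = aperiodic-shifts-differ aperiodic rb<ra (m%n<n a n) (λ t → sym (ra≗rb t))

  module _ {k : ℕ} (ascents<k : ascents (hat π) < k) where

    ascentWord : Fin n → Fin k
    ascentWord i = fromℕ< (≤-<-trans (countBelow-mono ascent? (<⇒≤pred (toℕ<n (π ⟨$⟩ʳ i)))) ascents<k)

    toℕ-ascentWord : ∀ a → toℕ (periodic ascentWord a) ≡ ascentsBelow (val a)
    toℕ-ascentWord a = toℕ-fromℕ< _

    ascentWord-compatible : Compatible ascentWord
    ascentWord-compatible a b a<b with m≤n⇒m<n∨m≡n (countBelow-mono ascent? (<⇒≤ a<b))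
    ... | inj₁ fewer = inj₁ (subst₂ _<_ (sym (toℕ-ascentWord a)) (sym (toℕ-ascentWord b)) fewer)
    ... | inj₂ same  =
      inj₂ ( toℕ-injective (trans (toℕ-ascentWord a) (trans same (sym (toℕ-ascentWord b))))
           , subst₂ _<_ (next-val b) (next-val a) (descending-run a<b (val<n b) same))

corollary3p9 : (k : ℕ) → 2 ≤ k → (n : ℕ) → {{_ : NonZero n}} → n % 4 ≢ 2 →
               (π : Permutation′ n) → InPatterns k π ⇔ (ascents (hat π) ≤ k ∸ 1)
corollary3p9 k 2≤k n n%4≢2 π = mk⇔
  (λ (w , _ , pat) → <⇒≤pred (compatible⇒ascents< w (pattern⇒compatible w pat)))
  (λ ascents≤ → realize (m≤pred[n]⇒suc[m]≤n {{>-nonZero (<-≤-trans z<s 2≤k)}} ascents≤))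
  where
  open CyclicPermutation π

  realize : ascents (hat π) < k → InPatterns k π
  realize ascents<k = w , aperiodic⇒primitive w aperiodic , ≺-of-<⇒pattern w (compatible⇒≺ w compat aperiodic)
    where
    w : Fin n → Fin k
    w = ascentWord ascents<k
    compat : Compatible w
    compat = ascentWord-compatible ascents<k
    aperiodic : Aperiodic w
    aperiodic = compatible⇒aperiodic w n%4≢2 compat
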